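{- Let $\mathcal D$ be a database schema with $|\mathcal D|\ge 2$, $\mathcal U$ a domain, and $\mathcal N=\{1,\dots,n\}$ with $n$ odd. An aggregation procedure $F:\mathcal D(\mathcal U)^n\to\mathcal D(\mathcal U)$ defined on the full domain $\mathcal D(\mathcal U)^n$ satisfies anonymity, negative neutrality, positive neutrality, independence and monotonicity if and only if it is the majority rule.
   Context: A database schema $\mathcal D$ is a finite set of relation symbols, each with an arity. Fix a countable domain $\mathcal U$. A $\mathcal D$-instance is a map $D$ assigning to each $P\in\mathcal D$ of arity $q$ a finite relation $D(P)\subseteq\mathcal U^q$; $\mathcal D(\mathcal U)$ is the set of all instances. For a profile $\vec D=(D_1,\dots,D_n)$, $N^{\vec D(P)}_{\vec u}=\{i\in\mathcal N:\vec u\in D_i(P)\}$. Anonymity: for every permutation $\pi$ of $\mathcal N$, $F(D_1,\dots,D_n)=F(D_{\pi(1)},\dots,D_{\pi(n)})$. Independence: if $N^{\vec D(P)}_{\vec u}=N^{\vec D'(P)}_{\vec u}$ then $\vec u\in F(\vec D)(P)$ iff $\vec u\in F(\vec D')(P)$. Positive neutrality: if $N^{\vec D(P)}_{\vec u}=N^{\vec D(P)}_{\vec u'}$ then $\vec u\in F(\vec D)(P)$ iff $\vec u'\in F(\vec D)(P)$. Negative neutrality: if $N^{\vec D(P)}_{\vec u}=\mathcal N\setminus N^{\vec D(P)}_{\vec u'}$ then $\vec u\in F(\vec D)(P)$ iff $\vec u'\notin F(\vec D)(P)$. Monotonicity: if $\vec u\in F(\vec D)(P)$ and for every $i$ either $D_i(P)=D'_i(P)$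 or $D_i(P)\cup\{\vec u\}\subseteq D'_i(P)$, then $\vec u\in F(\vec D')(P)$. (All these are required for all $P\in\mathcal D$, profiles and tuples.) The majority rule is defined by $\vec u\in F(\vec D)(P)$ iff $|N^{\vec D(P)}_{\vec u}|\ge\lceil (n+1)/2\rceil$. -}

module Defs where

open import Data.Nat using (ℕ; suc; _≤_; _*_; _+_; ⌈_/2⌉)
open import Data.Bool using (Bool; true; false; not)
open import Data.Fin using (Fin)
open import Data.Fin.Subset using (Subset; ∣_∣)
open import Data.Fin.Permutation using (Permutation′; _⟨$⟩ʳ_)
open import Data.Vec using (Vec; tabulate)
open import Data.List using (List)
open import Data.List.Membership.Propositional using (_∈_)
open import Data.Product using (Σ; ∃; _×_)
open import Data.Sum using (_⊎_)
open import Relation.Binary.PropositionalEquality using (_≡_)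
open import Function.Bundles using (_⇔_)
open import Function.Definitions using (Injective)

-- A finite relation of arity q over the domain U: a (decidable) membership
-- predicate on q-tuples together with a finite list containing all members.
FinRel : Set → ℕ → Set
FinRel U q = Σ (Vec U q → Bool) λ R → ∃ λ (l : List (Vec U q)) → ∀ u → R u ≡ true → u ∈ l

mem : ∀ {U q} → FinRel U q → Vec U q → Bool
mem R u = Data.Product.proj₁ R u

-- A schema with m relation symbols (Fin m) and arity function ar.
-- A D-instance assigns to each symbol P a finite relation of arity ar P.
Instance : Set → {m : ℕ} → (Fin m → ℕ) → Set
Instance U ar = ∀ P → FinRel U (ar P)

Profile : Set → {m : ℕ} → (Fin m → ℕ) → ℕ → Set
Profile U ar n = Fin n → Instance U ar

Aggregator : Set → {m : ℕ} → (Fin m → ℕ) → ℕ → Set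
Aggregator U ar n = Profile U ar n → Instance U ar

module _ {U : Set} {m : ℕ} {ar : Fin m → ℕ} {n : ℕ} where

  coalition : Profile U ar n → (P : Fin m) → Vec U (ar P) → Subset n
  coalition D P u = tabulate λ i → mem (D i P) u

  Anonymous : Aggregator U ar n → Set
  Anonymous F = ∀ (π : Permutation′ n) (D : Profile U ar n) P u →
    mem (F (λ i → D (π ⟨$⟩ʳ i)) P) u ≡ mem (F D P) u

  Independent : Aggregator U ar n → Set
  Independent F = ∀ (D D′ : Profile U ar n) P u →
    coalition D P u ≡ coalition D′ P u →
    mem (F D P) u ≡ mem (F D′ P) u

  PositiveNeutral : Aggregator U ar n → Set
  PositiveNeutral F = ∀ (D : Profile U ar n) P u u′ →
    coalition D P u ≡ coalition D P u′ →
    mem (F D P) u ≡ mem (F D P) u′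

  NegativeNeutral : Aggregator U ar n → Set
  NegativeNeutral F = ∀ (D : Profile U ar n) P u u′ →
    (∀ i → mem (D i P) u ≡ not (mem (D i P) u′)) →
    mem (F D P) u ≡ not (mem (F D P) u′)

  Monotone : Aggregator U ar n → Set
  Monotone F = ∀ (D D′ : Profile U ar n) P u →
    mem (F D P) u ≡ true →
    (∀ i → (∀ v → mem (D i P) v ≡ mem (D′ i P) v)
         ⊎ ((∀ v → mem (D i P) v ≡ true → mem (D′ i P) v ≡ true)
            × mem (D′ i P) u ≡ true)) →
    mem (F D′ P) u ≡ true

  IsMajorityRule : Aggregator U ar n → Set
  IsMajorityRule F = ∀ (D : Profile U ar n) P u →
    (mem (F D P) u ≡ true) ⇔ (⌈ suc n /2⌉ ≤ ∣ coalition D P u ∣)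

CountablyInfinite : Set → Set
CountablyInfinite U =
  (∃ λ (f : U → ℕ) → Injective _≡_ _≡_ f) × (∃ λ (g : ℕ → U) → Injective _≡_ _≡_ g)

Odd : ℕ → Set
Odd n = ∃ λ k → n ≡ suc (2 * k)

module Submission where

open import Defs
open import Data.Nat using (ℕ; zero; suc; _≤_; _+_; _*_; _∸_; z≤n; s≤s; ⌈_/2⌉; _≤?_)
open import Data.Nat.Properties
  using (≤-trans; n≤1+n; +-comm; m≤m+n; ≤-pred; ≰⇒>; n≮n; +-suc; +-identityʳ; +-mono-≤; +-cancelˡ-≤;
         m+n∸m≡n; m∸n+n≡m; n≡⌈n+n/2⌉; +-0-commutativeMonoid)
  renaming (_≟_ to _≟ℕ_)
open import Data.Bool using (Bool; true; false; not; _∧_; _∨_)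
open import Data.Bool.Properties using (not-involutive; ∧-zeroʳ; ∧-identityʳ; ∨-identityʳ)
open import Data.Fin using (Fin; zero; suc) renaming (_≟_ to _≟F_)
open import Data.Fin.Subset using (Subset; ∣_∣; ∁; _⊆_; _∈_; inside; outside)
open import Data.Fin.Subset.Properties using (∣p∣≤n; ∣∁p∣≡n∸∣p∣; p⊆q⇒∣p∣≤∣q∣)
open import Data.Fin.Permutation using (Permutation′; _⟨$⟩ʳ_; lift₀; transpose; _∘ₚ_)
  renaming (id to idₚ)
open import Data.Vec using (Vec; []; _∷_; lookup; tabulate; here; there)
open import Data.Vec.Properties
  using (tabulate-cong; tabulate∘lookup; lookup∘tabulate; lookup-map; tabulate-∘; []=⇒lookup; lookup⇒[]=;
         ∷-injectiveˡ; ≡-dec)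
open import Data.List using ([]; _∷_)
open import Data.List.Membership.Propositional using () renaming (_∈_ to _∈ₗ_)
open import Data.List.Relation.Unary.Any using () renaming (here to hereₗ; there to thereₗ)
open import Data.Product using (∃; _×_; _,_)
open import Data.Sum using (_⊎_; inj₁; inj₂)
open import Relation.Nullary using (¬_; Dec; yes; no; does; contradiction)
open import Relation.Nullary.Decidable using (dec-true; dec-false; via-injection)
open import Relation.Binary.Definitions using (DecidableEquality)
open import Relation.Binary.PropositionalEquality
open import Function using (_∘_)
open import Function.Bundles using (_⇔_; mk⇔; mk↣; Equivalence)
open import Algebra.Properties.CommutativeMonoid.Sum +-0-commutativeMonoid using (sum; sum-cong-≗; sum-permute)

-- Both directions pass through one fact about functions
-- h : ℕ → Bool turning a number of supporters into a verdict: for odd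
-- n = 2k+1, the increasing and self-dual ones (c + d = n implies
-- h c = not h d) are exactly the quota rule "at least k+1".  Then:
--   * Majority ⇒ axioms: the verdict on a tuple is the quota rule applied to
--     the size of its coalition; the axioms follow because the coalitions
--     involved have equal sizes, grow, or are complementary.
--   * Axioms ⇒ majority: fix P and tuples u ≠ w.  Profiles in which agents
--     hold only u and/or w in P realise every pair of coalitions.
--     Independence makes the verdict on u a function of its coalition,
--     anonymity a function of the coalition's size, monotonicity makes it
--     increasing, and the two neutralities make it self-dual.

-- Verdicts from supporter counts.

Increasing : (ℕ → Bool) → Set
Increasing h = ∀ {c d} → c ≤ d → h c ≡ true → h d ≡ true

SelfDual : ℕ → (ℕ → Bool) → Set
SelfDual n h = ∀ c d → c + d ≡ n → h c ≡ not (h d)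

atLeast : ℕ → ℕ → Bool
atLeast t c = does (t ≤? c)

does-unique : ∀ {A : Set} {b : Bool} → (b ≡ true ⇔ A) → (A? : Dec A) → b ≡ does A?
does-unique {b = true}  b⇔A A? = sym (dec-true A? (Equivalence.to b⇔A refl))
does-unique {b = false} b⇔A A? = sym (dec-false A? λ a → contradiction (Equivalence.from b⇔A a) λ ())

does-true : ∀ {A : Set} (A? : Dec A) → does A? ≡ true → A
does-true (yes a) _ = a

twice : ∀ k → 2 * k ≡ k + k
twice k = cong (k +_) (+-identityʳ k)

majority-quota : ∀ k → ⌈ suc (suc (2 * k)) /2⌉ ≡ suc k
majority-quota k = cong suc (sym (trans (n≡⌈n+n/2⌉ k) (cong ⌈_/2⌉ (sym (twice k)))))

not-both-reach : ∀ k c d → c + d ≡ suc (2 * k) → suc k ≤ c → ¬ (suc k ≤ d)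
not-both-reach k c d c+d≡n k<c k<d = n≮n k (+-cancelˡ-≤ k (suc k) k (≤-pred too-many))
  where
  too-many : suc (k + suc k) ≤ suc (k + k)
  too-many = subst (suc (k + suc k) ≤_) (trans c+d≡n (cong suc (twice k))) (+-mono-≤ k<c k<d)

one-reaches : ∀ k c d → c + d ≡ suc (2 * k) → ¬ (suc k ≤ d) → suc k ≤ c
one-reaches k c d c+d≡n k≮d with suc k ≤? c
... | yes k<c = k<c
... | no k≮c = contradiction (subst (_≤ k + k) (trans c+d≡n (cong suc (twice k))) c+d≤k+k) (n≮n (k + k))
  where
  c+d≤k+k : c + d ≤ k + k
  c+d≤k+k = +-mono-≤ (≤-pred (≰⇒> k≮c)) (≤-pred (≰⇒> k≮d))

atLeast-increasing : ∀ t → Increasing (atLeast t)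
atLeast-increasing t {c} {d} c≤d t≤c = dec-true (t ≤? d) (≤-trans (does-true (t ≤? c) t≤c) c≤d)

atLeast-selfDual : ∀ k → SelfDual (suc (2 * k)) (atLeast (suc k))
atLeast-selfDual k c d c+d≡n with suc k ≤? d
... | yes k<d = trans (dec-false (suc k ≤? c) λ k<c → not-both-reach k c d c+d≡n k<c k<d)
                      (cong not (sym (dec-true (suc k ≤? d) k<d)))
... | no k≮d = trans (dec-true (suc k ≤? c) (one-reaches k c d c+d≡n k≮d))
                     (cong not (sym (dec-false (suc k ≤? d) k≮d)))

selfDual-threshold : ∀ k (h : ℕ → Bool) → Increasing h → SelfDual (suc (2 * k)) h →
                     ∀ c → (h c ≡ true) ⇔ (suc k ≤ c)
selfDual-threshold k h increasing selfDual c = mk⇔ reaches supported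
  where
  k+k+1≡n : k + suc k ≡ suc (2 * k)
  k+k+1≡n = trans (+-suc k k) (cong suc (sym (twice k)))

  k-rejected : h k ≡ false
  k-rejected with h k in hk
  ... | false = refl
  ... | true = contradiction
    (trans (sym hk) (trans (selfDual k (suc k) k+k+1≡n) (cong not (increasing (n≤1+n k) hk)))) λ ()

  k+1-accepted : h (suc k) ≡ true
  k+1-accepted = trans (selfDual (suc k) k (trans (+-comm (suc k) k) k+k+1≡n)) (cong not k-rejected)

  reaches : h c ≡ true → suc k ≤ c
  reaches hc with suc k ≤? c
  ... | yes k<c = k<c
  ... | no k≮c = contradiction (trans (sym (increasing (≤-pred (≰⇒> k≮c)) hc)) k-rejected) λ ()

  supported : suc k ≤ c → h c ≡ true
  supported k<c = increasing k<c k+1-accepted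

-- Coalitions up to renaming the agents.

record Rearrangement {n} (S T : Subset n) : Set where
  constructor _,_
  field
    permutation : Permutation′ n
    renames     : ∀ i → lookup T i ≡ lookup S (permutation ⟨$⟩ʳ i)

rearrangement-refl : ∀ {n} (S : Subset n) → Rearrangement S S
rearrangement-refl S = idₚ , λ _ → refl

rearrangement-trans : ∀ {n} {S T V : Subset n} → Rearrangement S T → Rearrangement T V → Rearrangement S V
rearrangement-trans (π , T≡Sπ) (ρ , V≡Tρ) = ρ ∘ₚ π , λ i → trans (V≡Tρ i) (T≡Sπ _)

rearrangement-cons : ∀ {n} x {S T : Subset n} → Rearrangement S T → Rearrangement (x ∷ S) (x ∷ T)
rearrangement-cons x (π , T≡Sπ) = lift₀ π , λ { zero → refl ; (suc i) → T≡Sπ i }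

rearrangement-swap : ∀ {n} x y (S : Subset n) → Rearrangement (x ∷ y ∷ S) (y ∷ x ∷ S)
rearrangement-swap x y S =
  transpose zero (suc zero) , λ { zero → refl ; (suc zero) → refl ; (suc (suc i)) → refl }

-- the size of a coalition as a sum over the agents, to apply sum-permute
bit : Bool → ℕ
bit true  = 1
bit false = 0

size-as-sum : ∀ {n} (S : Subset n) → ∣ S ∣ ≡ sum (λ i → bit (lookup S i))
size-as-sum []          = refl
size-as-sum (true  ∷ S) = cong suc (size-as-sum S)
size-as-sum (false ∷ S) = size-as-sum S

rearrangement-size : ∀ {n} {S T : Subset n} → Rearrangement S T → ∣ T ∣ ≡ ∣ S ∣
rearrangement-size {S = S} {T} (π , T≡Sπ) = begin
  ∣ T ∣                                     ≡⟨ size-as-sum T ⟩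
  sum (λ i → bit (lookup T i))              ≡⟨ sum-cong-≗ (λ i → cong bit (T≡Sπ i)) ⟩
  sum (λ i → bit (lookup S (π ⟨$⟩ʳ i)))     ≡⟨ sum-permute (λ i → bit (lookup S i)) π ⟨
  sum (λ i → bit (lookup S i))              ≡⟨ size-as-sum S ⟨
  ∣ S ∣                                     ∎
  where open ≡-Reasoning

-- the coalition of the first c agents (all n agents if c ≥ n)
firstAgents : (n c : ℕ) → Subset n
firstAgents zero    c       = []
firstAgents (suc n) zero    = outside ∷ firstAgents n zero
firstAgents (suc n) (suc c) = inside ∷ firstAgents n c

firstAgents-size : ∀ n c → c ≤ n → ∣ firstAgents n c ∣ ≡ c
firstAgents-size zero    zero    _         = refl
firstAgents-size (suc n) zero    _         = firstAgents-size n zero z≤n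
firstAgents-size (suc n) (suc c) (s≤s c≤n) = cong suc (firstAgents-size n c c≤n)

firstAgents-⊆ : ∀ n {c d} → c ≤ d → firstAgents n c ⊆ firstAgents n d
firstAgents-⊆ (suc n) {zero}  {zero}  _         x∈ = x∈
firstAgents-⊆ (suc n) {zero}  {suc d} _         (there x∈) = there (firstAgents-⊆ n z≤n x∈)
firstAgents-⊆ (suc n) {suc c} {suc d} _         here = here
firstAgents-⊆ (suc n) {suc c} {suc d} (s≤s c≤d) (there x∈) = there (firstAgents-⊆ n c≤d x∈)

firstAgents-shift : ∀ n c → c ≤ n → Rearrangement (outside ∷ firstAgents n c) (firstAgents (suc n) c)
firstAgents-shift n       zero    _         = rearrangement-refl (firstAgents (suc n) zero)
firstAgents-shift (suc n) (suc c) (s≤s c≤n) = rearrangement-trans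
  (rearrangement-swap outside inside (firstAgents n c))
  (rearrangement-cons inside (firstAgents-shift n c c≤n))

to-firstAgents : ∀ {n} (S : Subset n) → Rearrangement S (firstAgents n ∣ S ∣)
to-firstAgents []           = rearrangement-refl []
to-firstAgents (true  ∷ S)  = rearrangement-cons inside (to-firstAgents S)
to-firstAgents (false ∷ S)  = rearrangement-trans
  (rearrangement-cons outside (to-firstAgents S)) (firstAgents-shift _ ∣ S ∣ (∣p∣≤n S))

∈-tabulate : ∀ {n} (f : Fin n → Bool) {i} → f i ≡ true → i ∈ tabulate f
∈-tabulate f {i} fi = lookup⇒[]= i (tabulate f) (trans (lookup∘tabulate f i) fi)

tabulate-∈ : ∀ {n} (f : Fin n → Bool) {i} → i ∈ tabulate f → f i ≡ true
tabulate-∈ f {i} i∈ = trans (sym (lookup∘tabulate f i)) ([]=⇒lookup i∈)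

complement-size : ∀ {n} (S : Subset n) → ∣ ∁ S ∣ + ∣ S ∣ ≡ n
complement-size S = trans (cong (_+ ∣ S ∣) (∣∁p∣≡n∸∣p∣ S)) (m∸n+n≡m (∣p∣≤n S))

module _ {U : Set} {m : ℕ} {ar : Fin m → ℕ} {n : ℕ} where

  coalition-of : ∀ (D : Profile U ar n) P u S → (∀ i → mem (D i P) u ≡ lookup S i) → coalition D P u ≡ S
  coalition-of D P u S holds = trans (tabulate-cong holds) (tabulate∘lookup S)

  coalition-permute : ∀ (π : Permutation′ n) (D : Profile U ar n) P u →
                      Rearrangement (coalition D P u) (coalition (λ i → D (π ⟨$⟩ʳ i)) P u)
  coalition-permute π D P u = π , λ i →
    trans (lookup∘tabulate _ i) (sym (lookup∘tabulate (λ j → mem (D j P) u) (π ⟨$⟩ʳ i)))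

  coalition-⊆ : ∀ (D D′ : Profile U ar n) P u → (∀ i → mem (D i P) u ≡ true → mem (D′ i P) u ≡ true) →
                coalition D P u ⊆ coalition D′ P u
  coalition-⊆ D D′ P u grows i∈ = ∈-tabulate _ (grows _ (tabulate-∈ _ i∈))

  coalition-∁ : ∀ (D : Profile U ar n) P u u′ → (∀ i → mem (D i P) u ≡ not (mem (D i P) u′)) →
                coalition D P u ≡ ∁ (coalition D P u′)
  coalition-∁ D P u u′ opposite = trans (tabulate-cong opposite) (tabulate-∘ not λ i → mem (D i P) u′)

-- the premise of monotonicity for a single agent: its relation R′ equals R,
-- or contains R together with the tuple u
Dominates : ∀ {U q} → FinRel U q → FinRel U q → Vec U q → Set
Dominates R R′ u = (∀ v → mem R v ≡ mem R′ v) ⊎ ((∀ v → mem R v ≡ true → mem R′ v ≡ true) × mem R′ u ≡ true)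

dominates-holds : ∀ {U q} (R R′ : FinRel U q) u → Dominates R R′ u → mem R u ≡ true → mem R′ u ≡ true
dominates-holds R R′ u (inj₁ same)      Ru = trans (sym (same u)) Ru
dominates-holds R R′ u (inj₂ (_ , R′u)) _  = R′u

module TwoTuples {U : Set} {q : ℕ} (_≟_ : DecidableEquality (Vec U q)) {u w : Vec U q} (u≢w : ¬ u ≡ w) where

  pairMember : Bool → Bool → Vec U q → Bool
  pairMember b c v = (b ∧ does (v ≟ u)) ∨ (c ∧ does (v ≟ w))

  pairMember-finite : ∀ b c v → pairMember b c v ≡ true → v ∈ₗ u ∷ w ∷ []
  pairMember-finite b c v member with v ≟ u | v ≟ w
  ... | yes refl | _        = hereₗ refl
  ... | no _     | yes refl = thereₗ (hereₗ refl)
  ... | no _     | no _     = contradiction (trans (sym (cong₂ _∨_ (∧-zeroʳ b) (∧-zeroʳ c))) member) λ ()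

  pairRel : Bool → Bool → FinRel U q
  pairRel b c = pairMember b c , u ∷ w ∷ [] , pairMember-finite b c

  pairRel-u : ∀ b c → mem (pairRel b c) u ≡ b
  pairRel-u b c rewrite dec-true (u ≟ u) refl | dec-false (u ≟ w) u≢w =
    trans (cong₂ _∨_ (∧-identityʳ b) (∧-zeroʳ c)) (∨-identityʳ b)

  pairRel-w : ∀ b c → mem (pairRel b c) w ≡ c
  pairRel-w b c rewrite dec-false (w ≟ u) (λ w≡u → u≢w (sym w≡u)) | dec-true (w ≟ w) refl =
    cong₂ _∨_ (∧-zeroʳ b) (∧-identityʳ c)

  pairRel-dominates : ∀ b b′ → (b ≡ true → b′ ≡ true) → Dominates (pairRel b b) (pairRel b′ b′) u
  pairRel-dominates false false _    = inj₁ λ _ → refl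
  pairRel-dominates false true  _    = inj₂ ((λ _ ()) , pairRel-u true true)
  pairRel-dominates true  true  _    = inj₁ λ _ → refl
  pairRel-dominates true  false b⇒b′ = contradiction (b⇒b′ refl) λ ()

module _ {U : Set} {m : ℕ} (ar : Fin m → ℕ) where

  onlyAt : (P : Fin m) → FinRel U (ar P) → Instance U ar
  onlyAt P R P′ with P ≟F P′
  ... | yes refl = R
  ... | no _     = (λ _ → false) , [] , λ _ ()

  onlyAt-self : ∀ P R → onlyAt P R P ≡ R
  onlyAt-self P R with P ≟F P
  ... | yes refl = refl
  ... | no P≢P   = contradiction refl P≢P

Axioms : ∀ {U m} {ar : Fin m → ℕ} {n} → Aggregator U ar n → Set
Axioms F = Anonymous F × NegativeNeutral F × PositiveNeutral F × Independent F × Monotone F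

-- The majority rule satisfies the axioms.

module MajorityRule {U : Set} {m : ℕ} {ar : Fin m → ℕ} (k : ℕ)
                    (F : Aggregator U ar (suc (2 * k))) (majority : IsMajorityRule F) where

  by-size : ∀ D P u → mem (F D P) u ≡ atLeast (suc k) ∣ coalition D P u ∣
  by-size D P u = does-unique
    (subst (λ t → (mem (F D P) u ≡ true) ⇔ (t ≤ ∣ coalition D P u ∣)) (majority-quota k) (majority D P u))
    (suc k ≤? ∣ coalition D P u ∣)

  same-size : ∀ D D′ P u u′ → ∣ coalition D P u ∣ ≡ ∣ coalition D′ P u′ ∣ → mem (F D P) u ≡ mem (F D′ P) u′
  same-size D D′ P u u′ sizes = trans (by-size D P u) (trans (cong (atLeast (suc k)) sizes) (sym (by-size D′ P u′)))

  anonymous : Anonymous F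
  anonymous π D P u = same-size _ D P u u (rearrangement-size (coalition-permute π D P u))

  independent : Independent F
  independent D D′ P u same = same-size D D′ P u u (cong ∣_∣ same)

  positiveNeutral : PositiveNeutral F
  positiveNeutral D P u u′ same = same-size D D P u u′ (cong ∣_∣ same)

  negativeNeutral : NegativeNeutral F
  negativeNeutral D P u u′ opposite = begin
    mem (F D P) u                                ≡⟨ by-size D P u ⟩
    atLeast (suc k) ∣ coalition D P u ∣          ≡⟨ cong (atLeast (suc k) ∘ ∣_∣) (coalition-∁ D P u u′ opposite) ⟩
    atLeast (suc k) ∣ ∁ (coalition D P u′) ∣     ≡⟨ atLeast-selfDual k ∣ ∁ (coalition D P u′) ∣ ∣ coalition D P u′ ∣
                                                      (complement-size (coalition D P u′)) ⟩
    not (atLeast (suc k) ∣ coalition D P u′ ∣)   ≡⟨ cong not (by-size D P u′) ⟨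
    not (mem (F D P) u′)                         ∎
    where open ≡-Reasoning

  monotone : Monotone F
  monotone D D′ P u Fu dominated =
    trans (by-size D′ P u) (atLeast-increasing (suc k) larger (trans (sym (by-size D P u)) Fu))
    where
    larger : ∣ coalition D P u ∣ ≤ ∣ coalition D′ P u ∣
    larger = p⊆q⇒∣p∣≤∣q∣ (coalition-⊆ D D′ P u λ i → dominates-holds (D i P) (D′ i P) u (dominated i))

  axioms : Axioms F
  axioms = anonymous , negativeNeutral , positiveNeutral , independent , monotone

-- The axioms force the majority rule.  Fix a symbol P and two distinct tuples
-- u and w of its arity; all profiles below only populate P, with u and w.

module Axioms⇒Majority {U : Set} {m : ℕ} {ar : Fin m → ℕ} {n : ℕ} (F : Aggregator U ar n)
                       (anonymous : Anonymous F) (negativeNeutral : NegativeNeutral F)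
                       (positiveNeutral : PositiveNeutral F) (independent : Independent F) (monotone : Monotone F)
                       (P : Fin m) (_≟_ : DecidableEquality (Vec U (ar P)))
                       {u w : Vec U (ar P)} (u≢w : ¬ u ≡ w) where

  open TwoTuples _≟_ u≢w

  twoTuples : Subset n → Subset n → Profile U ar n
  twoTuples S T i = onlyAt ar P (pairRel (lookup S i) (lookup T i))

  holds-u : ∀ S T i → mem (twoTuples S T i P) u ≡ lookup S i
  holds-u S T i = trans (cong (λ R → mem R u) (onlyAt-self ar P _)) (pairRel-u (lookup S i) (lookup T i))

  holds-w : ∀ S T i → mem (twoTuples S T i P) w ≡ lookup T i
  holds-w S T i = trans (cong (λ R → mem R w) (onlyAt-self ar P _)) (pairRel-w (lookup S i) (lookup T i))

  coalition-u : ∀ S T → coalition (twoTuples S T) P u ≡ S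
  coalition-u S T = coalition-of (twoTuples S T) P u S (holds-u S T)

  coalition-w : ∀ S T → coalition (twoTuples S T) P w ≡ T
  coalition-w S T = coalition-of (twoTuples S T) P w T (holds-w S T)

  verdict : Subset n → Bool
  verdict S = mem (F (twoTuples S S) P) u

  verdict-u : ∀ D → mem (F D P) u ≡ verdict (coalition D P u)
  verdict-u D = independent D (twoTuples S S) P u (sym (coalition-u S S))
    where S = coalition D P u

  verdict-w : ∀ D → mem (F D P) w ≡ verdict (coalition D P w)
  verdict-w D = begin
    mem (F D P) w                  ≡⟨ independent D (twoTuples S S) P w (sym (coalition-w S S)) ⟩
    mem (F (twoTuples S S) P) w    ≡⟨ positiveNeutral (twoTuples S S) P u w same ⟨
    verdict S                      ∎
    where
    open ≡-Reasoning
    S = coalition D P w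
    same : coalition (twoTuples S S) P u ≡ coalition (twoTuples S S) P w
    same = trans (coalition-u S S) (sym (coalition-w S S))

  verdict-∁ : ∀ S → verdict S ≡ not (verdict (∁ S))
  verdict-∁ S = begin
    verdict S                  ≡⟨ cong verdict (coalition-u S (∁ S)) ⟨
    verdict (coalition D P u)  ≡⟨ verdict-u D ⟨
    mem (F D P) u              ≡⟨ negativeNeutral D P u w opposite ⟩
    not (mem (F D P) w)        ≡⟨ cong not (trans (verdict-w D) (cong verdict (coalition-w S (∁ S)))) ⟩
    not (verdict (∁ S))        ∎
    where
    open ≡-Reasoning
    D = twoTuples S (∁ S)
    opposite : ∀ i → mem (D i P) u ≡ not (mem (D i P) w)
    opposite i = begin
      mem (D i P) u             ≡⟨ holds-u S (∁ S) i ⟩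
      lookup S i                ≡⟨ not-involutive (lookup S i) ⟨
      not (not (lookup S i))    ≡⟨ cong not (trans (holds-w S (∁ S) i) (lookup-map i not S)) ⟨
      not (mem (D i P) w)       ∎

  verdict-⊆ : ∀ {S T} → S ⊆ T → verdict S ≡ true → verdict T ≡ true
  verdict-⊆ {S} {T} S⊆T accepted = monotone (twoTuples S S) (twoTuples T T) P u accepted dominated
    where
    grows : ∀ i → lookup S i ≡ true → lookup T i ≡ true
    grows i Si = []=⇒lookup (S⊆T (lookup⇒[]= i S Si))
    dominated : ∀ i → Dominates (twoTuples S S i P) (twoTuples T T i P) u
    dominated i = subst₂ (λ R R′ → Dominates R R′ u) (sym (onlyAt-self ar P _)) (sym (onlyAt-self ar P _))
                         (pairRel-dominates (lookup S i) (lookup T i) (grows i))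

  verdict-rearrange : ∀ {S T} → Rearrangement S T → verdict T ≡ verdict S
  verdict-rearrange {S} {T} S↝T@(π , _) = begin
    verdict T                                    ≡⟨ cong verdict renamed ⟨
    verdict (coalition (λ i → D (π ⟨$⟩ʳ i)) P u)  ≡⟨ verdict-u _ ⟨
    mem (F (λ i → D (π ⟨$⟩ʳ i)) P) u             ≡⟨ anonymous π D P u ⟩
    verdict S                                    ∎
    where
    open ≡-Reasoning
    D = twoTuples S S
    renamed : coalition (λ i → D (π ⟨$⟩ʳ i)) P u ≡ T
    renamed = coalition-of (λ i → D (π ⟨$⟩ʳ i)) P u T λ i → trans (holds-u S S (π ⟨$⟩ʳ i)) (sym (Rearrangement.renames S↝T i))

  verdictBySize : ℕ → Bool
  verdictBySize c = verdict (firstAgents n c)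

  by-size : ∀ D → mem (F D P) u ≡ verdictBySize ∣ coalition D P u ∣
  by-size D = trans (verdict-u D) (sym (verdict-rearrange (to-firstAgents (coalition D P u))))

  verdictBySize-increasing : Increasing verdictBySize
  verdictBySize-increasing c≤d = verdict-⊆ (firstAgents-⊆ n c≤d)

  verdictBySize-selfDual : SelfDual n verdictBySize
  verdictBySize-selfDual c d c+d≡n = begin
    verdict (firstAgents n c)                        ≡⟨ verdict-∁ (firstAgents n c) ⟩
    not (verdict (∁ (firstAgents n c)))              ≡⟨ cong not (verdict-rearrange (to-firstAgents (∁ (firstAgents n c)))) ⟨
    not (verdictBySize ∣ ∁ (firstAgents n c) ∣)      ≡⟨ cong (not ∘ verdictBySize) complement-has-d ⟩
    not (verdictBySize d)                            ∎
    where
    open ≡-Reasoning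
    c≤n : c ≤ n
    c≤n = subst (c ≤_) c+d≡n (m≤m+n c d)
    complement-has-d : ∣ ∁ (firstAgents n c) ∣ ≡ d
    complement-has-d = begin
      ∣ ∁ (firstAgents n c) ∣       ≡⟨ ∣∁p∣≡n∸∣p∣ (firstAgents n c) ⟩
      n ∸ ∣ firstAgents n c ∣       ≡⟨ cong (n ∸_) (firstAgents-size n c c≤n) ⟩
      n ∸ c                         ≡⟨ cong (_∸ c) c+d≡n ⟨
      c + d ∸ c                     ≡⟨ m+n∸m≡n c d ⟩
      d                             ∎

another-tuple : ∀ {U : Set} (_≟_ : DecidableEquality U) {a b : U} → ¬ a ≡ b →
                ∀ {q} → 1 ≤ q → (u : Vec U q) → ∃ λ w → ¬ u ≡ w
another-tuple _≟_ {a} {b} a≢b (s≤s _) (x ∷ xs) with x ≟ a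
... | yes refl = b ∷ xs , λ u≡w → a≢b (∷-injectiveˡ u≡w)
... | no x≢a   = a ∷ xs , λ u≡w → x≢a (∷-injectiveˡ u≡w)

axioms⇒majority : ∀ {U : Set} {m} {ar : Fin m → ℕ} (_≟_ : DecidableEquality U) {a b : U} → ¬ a ≡ b →
                  (∀ P → 1 ≤ ar P) → ∀ k (F : Aggregator U ar (suc (2 * k))) → Axioms F → IsMajorityRule F
axioms⇒majority _≟_ a≢b positive-arity k F (anon , negN , posN , ind , mono) D P u
  with another-tuple _≟_ a≢b (positive-arity P) u
... | w , u≢w = subst (λ t → (mem (F D P) u ≡ true) ⇔ (t ≤ ∣ coalition D P u ∣)) (sym (majority-quota k))
                      (subst (λ b → (b ≡ true) ⇔ (suc k ≤ ∣ coalition D P u ∣)) (sym (by-size D))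
                             (selfDual-threshold k verdictBySize verdictBySize-increasing verdictBySize-selfDual
                                                 ∣ coalition D P u ∣))
  where open Axioms⇒Majority F anon negN posN ind mono P (≡-dec _≟_) u≢w

-- The theorem: for an odd number of agents, the axioms characterise the
-- majority rule.
lemma2 : (U : Set) → CountablyInfinite U →
         (m : ℕ) → 2 ≤ m → (ar : Fin m → ℕ) → (∀ P → 1 ≤ ar P) →
         (n : ℕ) → Odd n → (F : Aggregator U ar n) →
         (Anonymous F × NegativeNeutral F × PositiveNeutral F × Independent F × Monotone F)
           ⇔ IsMajorityRule F
lemma2 U ((code , code-injective) , (enum , enum-injective)) m _ ar positive-arity n (k , refl) F =
  mk⇔ (axioms⇒majority _≟U_ enum0≢enum1 positive-arity k F) (MajorityRule.axioms k F)
  where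
  _≟U_ : DecidableEquality U
  _≟U_ = via-injection (mk↣ code-injective) _≟ℕ_
  enum0≢enum1 : ¬ enum 0 ≡ enum 1
  enum0≢enum1 e = contradiction (enum-injective e) λ ()
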